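{- For every integer partition $\lambda$, the Garsia--Remmel $q$-rook number $R_1(\lambda; q)$ has a unimodal sequence of coefficients.
   Context: An integer partition $\lambda = \langle \lambda_1, \ldots, \lambda_\ell\rangle$ is a finite nonincreasing sequence of positive integers; its Ferrers board is $B_\lambda := \{(i,j) : 1 \le i \le \ell,\ 1 \le j \le \lambda_i\}$ (matrix coordinates: $i$ is the row, $j$ the column). A placement of $k$ (nonattacking) rooks on $B_\lambda$ is a $k$-element subset $w \subseteq B_\lambda$ no two elements of which agree in either coordinate. The inversion number $\mathrm{inv}(w)$ is defined as follows: for each rook $(a,b) \in w$, delete from $B_\lambda$ all cells $(i,b)$ with $i \le a$ and all cells $(a,j)$ with $j \le b$; $\mathrm{inv}(w)$ is the number of cells of $B_\lambda$ not deleted. The Garsia--Remmel $q$-rook number is $R_k(\lambda; q) := \sum_{w} q^{\mathrm{inv}(w)}$, the sum over all placements $w$ of $k$ rooks on $B_\lambda$. A polynomial $a_N q^N + \cdots + a_1 q + a_0$ is unimodal if for some $m$ one has $a_N \le a_{N-1} \le \cdots \le a_m \ge a_{m-1} \ge \cdots \ge a_0$. -}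

module Defs where

open import Data.Nat using (ℕ; zero; suc; _≤_; _≥_; _<_; _≡ᵇ_; _≤ᵇ_)
open import Data.Bool using (Bool; true; false; _∧_; _∨_; not; if_then_else_)
open import Data.Product using (_×_; _,_; proj₁; proj₂; ∃-syntax)
open import Data.List using (List; []; _∷_; map; _++_; upTo; length; filterᵇ)
open import Data.Bool.ListAction using (any; all)
open import Data.List.Relation.Unary.All using (All)
open import Data.List.Relation.Unary.Linked using (Linked)

IsPartition : List ℕ → Set
IsPartition λs = All (λ x → 0 < x) λs × Linked _≥_ λs

Cell : Set
Cell = ℕ × ℕ   -- (row i, column j), 1-indexed

-- Ferrers board B_λ = {(i,j) : 1 ≤ i ≤ ℓ, 1 ≤ j ≤ λ_i}, listed row by row.
boardFrom : ℕ → List ℕ → List Cell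
boardFrom i []       = []
boardFrom i (l ∷ ls) = map (λ j → (i , suc j)) (upTo l) ++ boardFrom (suc i) ls

board : List ℕ → List Cell
board = boardFrom 1

choose : ℕ → List Cell → List (List Cell)
choose zero    xs       = [] ∷ []
choose (suc k) []       = []
choose (suc k) (x ∷ xs) = map (x ∷_) (choose k xs) ++ choose (suc k) xs

attack : Cell → Cell → Bool
attack (a , b) (c , d) = (a ≡ᵇ c) ∨ (b ≡ᵇ d)

nonAttacking : List Cell → Bool
nonAttacking []       = true
nonAttacking (x ∷ xs) = all (λ y → not (attack x y)) xs ∧ nonAttacking xs

placements : ℕ → List ℕ → List (List Cell)
placements k λs = filterᵇ nonAttacking (choose k (board λs))

deletedBy : Cell → Cell → Bool
deletedBy (a , b) (i , j) = ((j ≡ᵇ b) ∧ (i ≤ᵇ a)) ∨ ((i ≡ᵇ a) ∧ (j ≤ᵇ b))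

inv : List ℕ → List Cell → ℕ
inv λs w = length (filterᵇ (λ c → not (any (λ r → deletedBy r c) w)) (board λs))

-- coefficient of q^n in the Garsia–Remmel q-rook number R_k(λ; q)
rookCoeff : ℕ → List ℕ → ℕ → ℕ
rookCoeff k λs n = length (filterᵇ (λ w → inv λs w ≡ᵇ n) (placements k λs))

Unimodal : (ℕ → ℕ) → Set
Unimodal a = ∃[ m ] ((∀ i j → i ≤ j → j ≤ m → a i ≤ a j)
                   × (∀ i j → m ≤ i → i ≤ j → a j ≤ a i))

-- A single rook on (a , b) deletes the a cells of its column weakly above it and the b cells of
-- its row weakly to its left, its own cell being counted twice; on a Ferrers board all these cells
-- exist. Hence inv = |B_λ| + 1 − (a + b), so the coefficients of R₁(λ; q), read backwards, are the
-- numbers d(t) of cells on the anti-diagonals i + j = t + 2 of B_λ. Deleting the first row of λ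
-- shifts the anti-diagonals by one, and an induction on the rows shows that d(t) = t + 1 up to the
-- size of the largest staircase inside λ and that d is nonincreasing from there on.
module Submission where

open import Defs
open import Data.Bool using (Bool; true; false; not; _∨_)
open import Data.Bool.Properties using (∧-identityʳ; ∧-zeroʳ; ∨-identityʳ; ∨-zeroʳ)
open import Data.List using (List; []; _∷_; [_]; map; _++_; upTo; applyUpTo; length; filterᵇ)
open import Data.List.Properties using (map-upTo)
open import Data.List.Membership.Propositional using (_∈_)
open import Data.List.Relation.Unary.Any using (here; there)
open import Data.List.Relation.Unary.All as All using (All; []; _∷_)
open import Data.List.Relation.Unary.All.Properties using (++⁺; map⁺; applyUpTo⁺₁)
open import Data.List.Relation.Unary.Linked as Linked using (Linked; [-]; _∷_)
open import Data.Nat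
open import Data.Nat.Properties
open import Data.Product using (_×_; _,_; proj₁; proj₂; ∃-syntax)
open import Data.Sum using (inj₁; inj₂)
open import Function using (_∘_)
open import Relation.Binary.PropositionalEquality hiding ([_])
open import Relation.Nullary using (yes; no; contradiction)

private
  variable
    A B : Set

toℕ : Bool → ℕ
toℕ false = 0
toℕ true  = 1

toℕ≤1 : ∀ b → toℕ b ≤ 1
toℕ≤1 false = z≤n
toℕ≤1 true  = ≤-refl

<ᵇ-true : ∀ {m n} → m < n → (m <ᵇ n) ≡ true
<ᵇ-true {zero}  {suc n} _         = refl
<ᵇ-true {suc m} {suc n} (s≤s m<n) = <ᵇ-true m<n

<ᵇ-false : ∀ {m n} → n ≤ m → (m <ᵇ n) ≡ false
<ᵇ-false z≤n       = refl
<ᵇ-false (s≤s n≤m) = <ᵇ-false n≤m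

≤ᵇ-true : ∀ {m n} → m ≤ n → (m ≤ᵇ n) ≡ true
≤ᵇ-true {zero}  _   = refl
≤ᵇ-true {suc m} m<n = <ᵇ-true m<n

≤ᵇ-false : ∀ {m n} → n < m → (m ≤ᵇ n) ≡ false
≤ᵇ-false {suc m} (s≤s n≤m) = <ᵇ-false n≤m

≡ᵇ-refl : ∀ n → (n ≡ᵇ n) ≡ true
≡ᵇ-refl zero    = refl
≡ᵇ-refl (suc n) = ≡ᵇ-refl n

≡ᵇ-false : ∀ {m n} → m ≢ n → (m ≡ᵇ n) ≡ false
≡ᵇ-false {zero}  {zero}  m≢n = contradiction refl m≢n
≡ᵇ-false {zero}  {suc n} _   = refl
≡ᵇ-false {suc m} {zero}  _   = refl
≡ᵇ-false {suc m} {suc n} m≢n = ≡ᵇ-false (m≢n ∘ cong suc)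

≡ᵇ-+-cancelˡ : ∀ i m n → (i + m ≡ᵇ i + n) ≡ (m ≡ᵇ n)
≡ᵇ-+-cancelˡ zero    m n = refl
≡ᵇ-+-cancelˡ (suc i) m n = ≡ᵇ-+-cancelˡ i m n

≡ᵇ-complementary : ∀ x y n m → x + y ≡ n + m → (x ≡ᵇ n) ≡ (y ≡ᵇ m)
≡ᵇ-complementary x y n m e with x ≟ n
... | yes refl rewrite +-cancelˡ-≡ x y m e = trans (≡ᵇ-refl x) (sym (≡ᵇ-refl m))
... | no  x≢n  = trans (≡ᵇ-false x≢n) (sym (≡ᵇ-false {y} {m} λ { refl → x≢n (+-cancelʳ-≡ y x n e) }))

≡ᵇ∨<ᵇ : ∀ j b → (suc j ≡ᵇ b) ∨ (j <ᵇ b) ≡ (j <ᵇ b)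
≡ᵇ∨<ᵇ _       zero    = refl
≡ᵇ∨<ᵇ zero    (suc b) = ∨-zeroʳ (0 ≡ᵇ b)
≡ᵇ∨<ᵇ (suc j) (suc b) = ≡ᵇ∨<ᵇ j b

<ᵇ-antitone : ∀ m n → toℕ (suc m <ᵇ n) ≤ toℕ (m <ᵇ n)
<ᵇ-antitone m       zero    = z≤n
<ᵇ-antitone zero    (suc n) = toℕ≤1 (0 <ᵇ n)
<ᵇ-antitone (suc m) (suc n) = <ᵇ-antitone m n

count : (A → Bool) → List A → ℕ
count p xs = length (filterᵇ p xs)

count-++ : ∀ (p : A → Bool) xs ys → count p (xs ++ ys) ≡ count p xs + count p ys
count-++ p []       ys = refl
count-++ p (x ∷ xs) ys with p x
... | true  = cong suc (count-++ p xs ys)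
... | false = count-++ p xs ys

count-map : ∀ (p : B → Bool) (f : A → B) xs → count p (map f xs) ≡ count (p ∘ f) xs
count-map p f []       = refl
count-map p f (x ∷ xs) with p (f x)
... | true  = cong suc (count-map p f xs)
... | false = count-map p f xs

count-cong : ∀ {p q : A → Bool} {xs} → All (λ x → p x ≡ q x) xs → count p xs ≡ count q xs
count-cong         {xs = []}     []       = refl
count-cong {q = q} {xs = x ∷ xs} (e ∷ es) rewrite e with q x
... | true  = cong suc (count-cong es)
... | false = count-cong es

count-none : ∀ {p : A → Bool} {xs} → All (λ x → p x ≡ false) xs → count p xs ≡ 0
count-none []       = refl
count-none (e ∷ es) rewrite e = count-none es

count-not : ∀ (p : A → Bool) xs → count (not ∘ p) xs + count p xs ≡ length xs
count-not p []       = refl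
count-not p (x ∷ xs) with p x
... | true  = trans (+-suc _ _) (cong suc (count-not p xs))
... | false = cong suc (count-not p xs)

count-∷ : ∀ (p : A → Bool) x xs → count p (x ∷ xs) ≡ toℕ (p x) + count p xs
count-∷ p x xs with p x
... | true  = refl
... | false = refl

count-upTo-suc : ∀ (p : ℕ → Bool) l → count p (upTo (suc l)) ≡ toℕ (p 0) + count (p ∘ suc) (upTo l)
count-upTo-suc p l =
  trans (count-∷ p 0 (applyUpTo suc l))
        (cong (toℕ (p 0) +_) (trans (cong (count p) (sym (map-upTo suc l))) (count-map p suc (upTo l))))

count-≡ᵇ-upTo : ∀ t l → count (_≡ᵇ t) (upTo l) ≡ toℕ (t <ᵇ l)
count-≡ᵇ-upTo t       zero    = refl
count-≡ᵇ-upTo zero    (suc l) =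
  trans (count-upTo-suc (_≡ᵇ 0) l) (cong suc (count-none (All.universal (λ _ → refl) (upTo l))))
count-≡ᵇ-upTo (suc t) (suc l) = trans (count-upTo-suc (_≡ᵇ suc t) l) (count-≡ᵇ-upTo t l)

count-<ᵇ-upTo : ∀ {b l} → b ≤ l → count (_<ᵇ b) (upTo l) ≡ b
count-<ᵇ-upTo {zero}  {l}     _         = count-none (All.universal (λ _ → refl) (upTo l))
count-<ᵇ-upTo {suc b} {suc l} (s≤s b≤l) =
  trans (count-upTo-suc (_<ᵇ suc b) l) (cong suc (count-<ᵇ-upTo b≤l))

row : ℕ → ℕ → List Cell
row i l = map (λ j → (i , suc j)) (upTo l)

boardFrom-All : ∀ {P : Cell → Set} i ls →
  (∀ {r l j} → i ≤ r → l ∈ ls → j < l → P (r , suc j)) → All P (boardFrom i ls)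
boardFrom-All i []       _ = []
boardFrom-All i (l ∷ ls) h =
  ++⁺ (map⁺ (applyUpTo⁺₁ _ l (h ≤-refl (here refl))))
      (boardFrom-All (suc i) ls (λ i<r l′∈ls → h (<⇒≤ i<r) (there l′∈ls)))

bounded-by-head : ∀ {l ls} → Linked _≥_ (l ∷ ls) → All (_≤ l) ls
bounded-by-head [-]          = []
bounded-by-head (l′≤l ∷ lk) = l′≤l ∷ All.map (λ x≤l′ → ≤-trans x≤l′ l′≤l) (bounded-by-head lk)

data Within (i m : ℕ) : Cell → Set where
  within : ∀ {r j} → i ≤ r → j < m → Within i m (r , suc j)

deletedBy-sameRow : ∀ a b j → deletedBy (a , b) (a , suc j) ≡ (j <ᵇ b)
deletedBy-sameRow a b j rewrite ≤ᵇ-true (≤-refl {a}) | ≡ᵇ-refl a | ∧-identityʳ (suc j ≡ᵇ b) =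
  ≡ᵇ∨<ᵇ j b

deletedBy-rowAbove : ∀ {i a} b j → i < a → deletedBy (a , b) (i , j) ≡ (j ≡ᵇ b)
deletedBy-rowAbove b j i<a rewrite ≤ᵇ-true (<⇒≤ i<a) | ≡ᵇ-false (<⇒≢ i<a) =
  trans (∨-identityʳ _) (∧-identityʳ _)

deletedBy-rowBelow : ∀ {i a} b j → a < i → deletedBy (a , b) (i , j) ≡ false
deletedBy-rowBelow b j a<i rewrite ≤ᵇ-false a<i | ≡ᵇ-false (>⇒≢ a<i) =
  trans (∨-identityʳ _) (∧-zeroʳ _)

count-deletedBy-sameRow : ∀ {i b l} → b ≤ l → count (deletedBy (i , b)) (row i l) ≡ b
count-deletedBy-sameRow {i} {b} {l} b≤l = begin
  count (deletedBy (i , b)) (row i l)                  ≡⟨ count-map _ _ (upTo l) ⟩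
  count (λ j → deletedBy (i , b) (i , suc j)) (upTo l) ≡⟨ count-cong (All.universal (deletedBy-sameRow i b) (upTo l)) ⟩
  count (_<ᵇ b) (upTo l)                               ≡⟨ count-<ᵇ-upTo b≤l ⟩
  b                                                    ∎
  where open ≡-Reasoning

count-deletedBy-rowAbove : ∀ {i a b l} → i < a → b < l → count (deletedBy (a , suc b)) (row i l) ≡ 1
count-deletedBy-rowAbove {i} {a} {b} {l} i<a b<l = begin
  count (deletedBy (a , suc b)) (row i l)                  ≡⟨ count-map _ _ (upTo l) ⟩
  count (λ j → deletedBy (a , suc b) (i , suc j)) (upTo l)
    ≡⟨ count-cong (All.universal (λ j → deletedBy-rowAbove (suc b) (suc j) i<a) (upTo l)) ⟩
  count (_≡ᵇ b) (upTo l)                                   ≡⟨ count-≡ᵇ-upTo b l ⟩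
  toℕ (b <ᵇ l)                                             ≡⟨ cong toℕ (<ᵇ-true b<l) ⟩
  1                                                        ∎
  where open ≡-Reasoning

-- Rows i, …, a − 1 each contain one cell deleted by the rook (a , b), and row a contains b of them.
count-deletedBy : ∀ i ls → Linked _≥_ ls →
  All (λ c → count (deletedBy c) (boardFrom i ls) + i ≡ proj₁ c + proj₂ c) (boardFrom i ls)
count-deletedBy i []       _  = []
count-deletedBy i (l ∷ ls) lk =
  ++⁺ (map⁺ (applyUpTo⁺₁ _ l inRow))
      (All.zipWith inLowerRow (count-deletedBy (suc i) ls (Linked.tail lk) , boardFrom-All (suc i) ls within-l))
  where
  open ≡-Reasoning
  lower : List Cell
  lower = boardFrom (suc i) ls

  within-l : ∀ {r l′ j} → suc i ≤ r → l′ ∈ ls → j < l′ → Within (suc i) l (r , suc j)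
  within-l i<r l′∈ls j<l′ = within i<r (≤-trans j<l′ (All.lookup (bounded-by-head lk) l′∈ls))

  inRow : ∀ {j} → j < l → count (deletedBy (i , suc j)) (row i l ++ lower) + i ≡ i + suc j
  inRow {j} j<l = begin
    count (deletedBy (i , suc j)) (row i l ++ lower) + i
      ≡⟨ cong (_+ i) (count-++ _ (row i l) lower) ⟩
    count (deletedBy (i , suc j)) (row i l) + count (deletedBy (i , suc j)) lower + i
      ≡⟨ cong₂ (λ u v → u + v + i) (count-deletedBy-sameRow j<l)
               (count-none (boardFrom-All (suc i) ls
                             (λ {_} {_} {j′} i<r _ _ → deletedBy-rowBelow (suc j) (suc j′) i<r))) ⟩
    suc j + 0 + i
      ≡⟨ trans (cong (_+ i) (+-identityʳ (suc j))) (+-comm (suc j) i) ⟩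
    i + suc j
      ∎

  inLowerRow : ∀ {c} → (count (deletedBy c) lower + suc i ≡ proj₁ c + proj₂ c) × Within (suc i) l c →
               count (deletedBy c) (row i l ++ lower) + i ≡ proj₁ c + proj₂ c
  inLowerRow (ih , within {a} {b} i<a b<l) = begin
    count (deletedBy (a , suc b)) (row i l ++ lower) + i
      ≡⟨ cong (_+ i) (count-++ _ (row i l) lower) ⟩
    count (deletedBy (a , suc b)) (row i l) + count (deletedBy (a , suc b)) lower + i
      ≡⟨ cong (λ u → u + count (deletedBy (a , suc b)) lower + i) (count-deletedBy-rowAbove i<a b<l) ⟩
    suc (count (deletedBy (a , suc b)) lower) + i
      ≡⟨ sym (+-suc _ i) ⟩
    count (deletedBy (a , suc b)) lower + suc i
      ≡⟨ ih ⟩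
    a + suc b
      ∎

inv-single-rook : ∀ {λs} → Linked _≥_ λs →
  All (λ c → inv λs [ c ] + (proj₁ c + proj₂ c) ≡ suc (length (board λs))) (board λs)
inv-single-rook {λs} lk = All.map invFromDeleted (count-deletedBy 1 λs lk)
  where
  open ≡-Reasoning
  Bλ : List Cell
  Bλ = board λs

  invFromDeleted : ∀ {c} → count (deletedBy c) Bλ + 1 ≡ proj₁ c + proj₂ c →
                   inv λs [ c ] + (proj₁ c + proj₂ c) ≡ suc (length Bλ)
  invFromDeleted {c} e = begin
    inv λs [ c ] + (proj₁ c + proj₂ c)
      ≡⟨ cong₂ _+_ (count-cong (All.universal (λ c′ → cong not (∨-identityʳ (deletedBy c c′))) Bλ)) (sym e) ⟩
    count (not ∘ deletedBy c) Bλ + (count (deletedBy c) Bλ + 1)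
      ≡⟨ sym (+-assoc (count (not ∘ deletedBy c) Bλ) (count (deletedBy c) Bλ) 1) ⟩
    count (not ∘ deletedBy c) Bλ + count (deletedBy c) Bλ + 1
      ≡⟨ cong (_+ 1) (count-not (deletedBy c) Bλ) ⟩
    length Bλ + 1
      ≡⟨ +-comm (length Bλ) 1 ⟩
    suc (length Bλ)
      ∎

-- diagonal λs t is the number of cells (i , j) of B_λ with i + j = t + 2 (see count-diagonal).
diagonal : List ℕ → ℕ → ℕ
diagonal []       _       = 0
diagonal (l ∷ _)  zero    = toℕ (0 <ᵇ l)
diagonal (l ∷ ls) (suc t) = toℕ (suc t <ᵇ l) + diagonal ls t

count-diagonal-row : ∀ i l t → count (λ c → proj₁ c + proj₂ c ≡ᵇ i + suc t) (row i l) ≡ toℕ (t <ᵇ l)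
count-diagonal-row i l t =
  trans (count-map _ _ (upTo l))
        (trans (count-cong (All.universal (λ j → ≡ᵇ-+-cancelˡ i (suc j) (suc t)) (upTo l)))
               (count-≡ᵇ-upTo t l))

count-diagonal : ∀ i ls t → count (λ c → proj₁ c + proj₂ c ≡ᵇ i + suc t) (boardFrom i ls) ≡ diagonal ls t
count-diagonal i []       t       = refl
count-diagonal i (l ∷ ls) zero    =
  trans (count-++ _ (row i l) (boardFrom (suc i) ls))
        (trans (cong₂ _+_ (count-diagonal-row i l 0) (count-none (boardFrom-All (suc i) ls below)))
               (+-identityʳ _))
  where
  below : ∀ {r l′ j} → suc i ≤ r → l′ ∈ ls → j < l′ → (r + suc j ≡ᵇ i + 1) ≡ false
  below i<r _ _ = ≡ᵇ-false (>⇒≢ (+-mono-<-≤ i<r (s≤s z≤n)))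
count-diagonal i (l ∷ ls) (suc t) =
  trans (count-++ _ (row i l) (boardFrom (suc i) ls))
        (cong₂ _+_ (count-diagonal-row i l (suc t))
                   (trans (count-cong (All.universal (λ c → cong (proj₁ c + proj₂ c ≡ᵇ_) (+-suc i (suc t)))
                                                     (boardFrom (suc i) ls)))
                          (count-diagonal (suc i) ls t)))

filter-nonAttacking-choose₁ : ∀ xs → filterᵇ nonAttacking (choose 1 xs) ≡ map [_] xs
filter-nonAttacking-choose₁ []       = refl
filter-nonAttacking-choose₁ (x ∷ xs) = cong ([ x ] ∷_) (filter-nonAttacking-choose₁ xs)

rookCoeff₁ : ∀ λs n → rookCoeff 1 λs n ≡ count (λ c → inv λs [ c ] ≡ᵇ n) (board λs)
rookCoeff₁ λs n =
  trans (cong (count (λ w → inv λs w ≡ᵇ n)) (filter-nonAttacking-choose₁ (board λs)))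
        (count-map _ [_] (board λs))

Reversal : ℕ → (ℕ → ℕ) → (ℕ → ℕ) → Set
Reversal N d a = (∀ n t → n + suc t ≡ N → a n ≡ d t) × (∀ n → N ≤ n → a n ≡ 0)

rookCoeff-reversal : ∀ {λs} → Linked _≥_ λs → Reversal (length (board λs)) (diagonal λs) (rookCoeff 1 λs)
rookCoeff-reversal {λs} lk = onDiagonal , beyondBoard
  where
  N : ℕ
  N = length (board λs)

  onDiagonal : ∀ n t → n + suc t ≡ N → rookCoeff 1 λs n ≡ diagonal λs t
  onDiagonal n t e = begin
    rookCoeff 1 λs n                                         ≡⟨ rookCoeff₁ λs n ⟩
    count (λ c → inv λs [ c ] ≡ᵇ n) (board λs)               ≡⟨ count-cong (All.map sameTest (inv-single-rook lk)) ⟩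
    count (λ c → proj₁ c + proj₂ c ≡ᵇ 2 + t) (board λs)     ≡⟨ count-diagonal 1 λs t ⟩
    diagonal λs t                                            ∎
    where
    open ≡-Reasoning
    sameTest : ∀ {c} → inv λs [ c ] + (proj₁ c + proj₂ c) ≡ suc N →
               (inv λs [ c ] ≡ᵇ n) ≡ (proj₁ c + proj₂ c ≡ᵇ 2 + t)
    sameTest {c} h = ≡ᵇ-complementary (inv λs [ c ]) (proj₁ c + proj₂ c) n (2 + t)
                       (trans h (sym (trans (+-suc n (suc t)) (cong suc e))))

  inv<N : ∀ {c} → inv λs [ c ] + (proj₁ c + proj₂ c) ≡ suc N → 2 ≤ proj₁ c + proj₂ c → inv λs [ c ] < N
  inv<N {c} h 2≤ab = s≤s⁻¹ (begin
    2 + inv λs [ c ]                    ≡⟨ +-comm 2 _ ⟩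
    inv λs [ c ] + 2                    ≤⟨ +-monoʳ-≤ _ 2≤ab ⟩
    inv λs [ c ] + (proj₁ c + proj₂ c) ≡⟨ h ⟩
    suc N                               ∎)
    where open ≤-Reasoning

  beyondBoard : ∀ n → N ≤ n → rookCoeff 1 λs n ≡ 0
  beyondBoard n N≤n =
    trans (rookCoeff₁ λs n)
          (count-none (All.zipWith (λ (h , 2≤ab) → ≡ᵇ-false (<⇒≢ (<-≤-trans (inv<N h 2≤ab) N≤n)))
                                   (inv-single-rook lk , boardFrom-All 1 λs λ 1≤r _ _ → +-mono-≤ 1≤r (s≤s z≤n))))

Rising : (ℕ → ℕ) → ℕ → Set
Rising a m = ∀ t → t < m → a t ≤ a (suc t)

Falling : (ℕ → ℕ) → ℕ → Set
Falling a m = ∀ t → m ≤ t → a (suc t) ≤ a t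

Peak : (ℕ → ℕ) → ℕ → Set
Peak a m = Rising a m × Falling a m

rising-≤′ : ∀ {a m i j} → Rising a m → i ≤′ j → j ≤ m → a i ≤ a j
rising-≤′ rise ≤′-refl            _     = ≤-refl
rising-≤′ rise (≤′-step {n} i≤′n) n<m = ≤-trans (rising-≤′ rise i≤′n (<⇒≤ n<m)) (rise n n<m)

falling-≤′ : ∀ {a m i j} → Falling a m → m ≤ i → i ≤′ j → a j ≤ a i
falling-≤′ fall m≤i ≤′-refl            = ≤-refl
falling-≤′ fall m≤i (≤′-step {n} i≤′n) =
  ≤-trans (fall n (≤-trans m≤i (≤′⇒≤ i≤′n))) (falling-≤′ fall m≤i i≤′n)

Peak⇒Unimodal : ∀ {a m} → Peak a m → Unimodal a
Peak⇒Unimodal {m = m} (rise , fall) =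
  m , (λ i j i≤j j≤m → rising-≤′ rise (≤⇒≤′ i≤j) j≤m) , (λ i j m≤i i≤j → falling-≤′ fall m≤i (≤⇒≤′ i≤j))

reversal-rising : ∀ {N d a m} → Reversal N d a → Falling d m → Rising a (N ∸ suc m)
reversal-rising {N} {d} {a} {m} (rev , _) fall t t<M with m≤n⇒∃[o]m+o≡n fits
  where
  fits : suc t + suc m ≤ N
  fits = m≤o∸n⇒m+n≤o (suc t) (<⇒≤ (m∸n≢0⇒n<m (>⇒≢ (<-≤-trans (s≤s z≤n) t<M)))) t<M
... | o , e = begin
  a t               ≡⟨ rev t (suc (m + o)) (trans (+-suc t _) e′) ⟩
  d (suc (m + o))   ≤⟨ fall (m + o) (m≤m+n m o) ⟩
  d (m + o)         ≡⟨ sym (rev (suc t) (m + o) e′) ⟩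
  a (suc t)         ∎
  where
  open ≤-Reasoning
  e′ : suc t + suc (m + o) ≡ N
  e′ = trans (sym (+-assoc (suc t) (suc m) o)) e

reversal-falling : ∀ {N d a m} → Reversal N d a → Rising d m → Falling a (N ∸ suc m)
reversal-falling {N} {d} {a} {m} (rev , beyond) rise t M≤t with N ≤? suc t
... | yes N≤st rewrite beyond (suc t) N≤st = z≤n
... | no  N≰st with m≤n⇒∃[o]m+o≡n (≰⇒> N≰st)
...   | o , e = begin
  a (suc t)   ≡⟨ rev (suc t) o e′ ⟩
  d o         ≤⟨ rise o o<m ⟩
  d (suc o)   ≡⟨ sym (rev t (suc o) (trans (+-suc t (suc o)) e′)) ⟩
  a t         ∎
  where
  open ≤-Reasoning
  e′ : suc t + suc o ≡ N
  e′ = trans (+-suc (suc t) o) e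
  o<m : o < m
  o<m = +-cancelˡ-≤ (suc t) (suc o) m (begin
    suc t + suc o              ≡⟨ e′ ⟩
    N                          ≤⟨ m≤n+m∸n N (suc m) ⟩
    suc m + (N ∸ suc m)        ≤⟨ +-monoʳ-≤ (suc m) M≤t ⟩
    suc m + t                  ≡⟨ +-comm (suc m) t ⟩
    t + suc m                  ≡⟨ +-suc t m ⟩
    suc t + m                  ∎)

reversal-peak : ∀ {N d a m} → Reversal N d a → Peak d m → Peak a (N ∸ suc m)
reversal-peak rev (rise , fall) = reversal-rising rev fall , reversal-falling rev rise

rising-falling-gap : ∀ {a m} → Rising a m → Falling a (suc m) → ∃[ p ] Peak a p
rising-falling-gap {a} {m} rise fall with a (suc m) ≤? a m
... | yes down = m , rise , fallFrom-m
  where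
  fallFrom-m : Falling a m
  fallFrom-m t m≤t with m≤n⇒m<n∨m≡n m≤t
  ... | inj₁ m<t  = fall t m<t
  ... | inj₂ refl = down
... | no  up   = suc m , riseTo-suc-m , fall
  where
  riseTo-suc-m : Rising a (suc m)
  riseTo-suc-m t t<sm with m<1+n⇒m<n∨m≡n t<sm
  ... | inj₁ t<m  = rise t t<m
  ... | inj₂ refl = <⇒≤ (≰⇒> up)

Staircase : (ℕ → ℕ) → ℕ → Set
Staircase d k = ∀ t → t < k → d t ≡ suc t

staircase-rising : ∀ {d m} → Staircase d (suc m) → Rising d m
staircase-rising stair t t<m rewrite stair t (m<n⇒m<1+n t<m) | stair (suc t) (s≤s t<m) = n≤1+n (suc t)

staircase-peak : ∀ {d k} → Staircase d k → Falling d k → ∃[ p ] Peak d p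
staircase-peak {k = zero}  _     fall = 0 , (λ _ ()) , fall
staircase-peak {k = suc m} stair fall = rising-falling-gap (staircase-rising stair) fall

diagonal-≤-suc : ∀ ls t → diagonal ls t ≤ suc t
diagonal-≤-suc []       t       = z≤n
diagonal-≤-suc (l ∷ ls) zero    = toℕ≤1 (0 <ᵇ l)
diagonal-≤-suc (l ∷ ls) (suc t) = +-mono-≤ (toℕ≤1 _) (diagonal-≤-suc ls t)

diagonal-tail-≤ : ∀ {l ls} → Linked _≥_ (l ∷ ls) → ∀ t → diagonal ls t ≤ l
diagonal-tail-≤ [-] t = z≤n
diagonal-tail-≤ {ls = zero ∷ _}  _           zero    = z≤n
diagonal-tail-≤ {ls = suc _ ∷ _} (l₁≤l ∷ _)  zero    = ≤-trans (s≤s z≤n) l₁≤l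
diagonal-tail-≤ {ls = l₁ ∷ ls}   (l₁≤l ∷ lk) (suc t) with suc t <? l₁
... | yes t<l₁ rewrite <ᵇ-true t<l₁ = ≤-trans (s≤s (diagonal-≤-suc ls t)) (≤-trans t<l₁ l₁≤l)
... | no  t≮l₁ rewrite <ᵇ-false (≮⇒≥ t≮l₁) = ≤-trans (diagonal-tail-≤ lk t) l₁≤l

-- Adding a first row l extends the staircase by one step if it still fits under l, and otherwise cuts it
-- off at l; beyond the cut the old staircase values exceed l, which bounds every later anti-diagonal.
diagonal-staircase : ∀ {ls} → IsPartition ls → ∃[ k ] (Staircase (diagonal ls) k × Falling (diagonal ls) k)
diagonal-staircase {[]}         _ = 0 , (λ _ ()) , (λ _ _ → z≤n)
diagonal-staircase {zero ∷ _}   (() ∷ _ , _)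
diagonal-staircase {suc l ∷ ls} (_ ∷ pos , lk) with diagonal-staircase (pos , Linked.tail lk)
... | k , stair , fall with k ≤? l
...   | yes k≤l = suc k , stair′ , fall′
  where
  stair′ : Staircase (diagonal (suc l ∷ ls)) (suc k)
  stair′ zero    _         = refl
  stair′ (suc t) (s≤s t<k) rewrite <ᵇ-true (<-≤-trans t<k k≤l) | stair t t<k = refl

  fall′ : Falling (diagonal (suc l ∷ ls)) (suc k)
  fall′ (suc t) (s≤s k≤t) = +-mono-≤ (<ᵇ-antitone t l) (fall t k≤t)
...   | no  k≰l = suc l , stair′ , fall′
  where
  stair′ : Staircase (diagonal (suc l ∷ ls)) (suc l)
  stair′ zero    _         = refl
  stair′ (suc t) (s≤s t<l) rewrite <ᵇ-true t<l | stair t (<-trans t<l (≰⇒> k≰l)) = refl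

  fall′ : Falling (diagonal (suc l ∷ ls)) (suc l)
  fall′ (suc t) (s≤s l≤t) rewrite <ᵇ-false (m≤n⇒m≤1+n l≤t) | <ᵇ-false l≤t with k ≤? t
  ... | yes k≤t = fall t k≤t
  ... | no  k≰t rewrite stair t (≰⇒> k≰t) = ≤-trans (diagonal-tail-≤ lk (suc t)) (s≤s l≤t)

diagonal-peak : ∀ {ls} → IsPartition ls → ∃[ m ] Peak (diagonal ls) m
diagonal-peak partition with diagonal-staircase partition
... | k , stair , fall = staircase-peak stair fall

proposition2 : (λs : List ℕ) → IsPartition λs → Unimodal (rookCoeff 1 λs)
proposition2 λs partition@(_ , nonincreasing) with diagonal-peak partition
... | m , peak = Peak⇒Unimodal (reversal-peak (rookCoeff-reversal nonincreasing) peak)
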